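{- For every integer $k\geq 2$, the extended double cover $EDC(SPC(k-1))$ is isomorphic to $SPC(k)$.
   Context: A signed graph $(G,\sigma)$ is a graph $G$ together with an assignment $\sigma:E(G)\to\{+,-\}$; between two vertices there may be at most one positive and at most one negative edge (two such edges form a digon). For an abelian group $\Gamma$ and subsets $S^+,S^-\subseteq\Gamma$ with $-S^+=S^+$, $-S^-=S^-$, the signed Cayley graph $(\Gamma,S^+,S^-)$ has vertex set $\Gamma$, a positive edge $xy$ iff $x-y\in S^+$ and a negative edge $xy$ iff $x-y\in S^-$. The signed projective cube of dimension $k\ge 1$ is $SPC(k)=(\mathbb{Z}_2^k,\{e_1,\dots,e_k\},\{J\})$, where $e_1,\dots,e_k$ is the standard basis and $J$ is the all-ones vector (so $SPC(1)$ is a digon). For a signed graph $(G,\sigma)$, its extended double cover $EDC(G,\sigma)$ is the signed graph with two vertices $x_0,x_1$ for each vertex $x$ of $G$, joined by a negative edge; for each positive edge $xy$ of $(G,\sigma)$ it has the positive edges $x_0y_0$ and $x_1y_1$; for each negative edge $xy$ of $(G,\sigma)$ it has the positive edges $x_0y_1$ and $x_1y_0$; there are no other edges. Isomorphism of signed graphs is a graph isomorphism preserving the signs of the edges. -}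

module Defs where

open import Level using (0ℓ)
open import Data.Nat using (ℕ; _∸_)
open import Data.Bool using (Bool; true; false; _xor_)
open import Data.Fin using (Fin; _≟_)
open import Data.Vec using (Vec; zipWith; replicate; tabulate)
open import Data.Product using (Σ; _×_; _,_; ∃-syntax)
open import Data.Sum using (_⊎_)
open import Relation.Nullary using (¬_)
open import Relation.Nullary.Decidable using (⌊_⌋)
open import Relation.Binary.PropositionalEquality using (_≡_)
open import Function.Bundles using (_↔_; _⇔_; Inverse)

-- A signed graph: a vertex set together with a positive and a negative
-- adjacency relation (at most one positive and one negative edge between
-- two vertices, so edges of each sign are given by a relation).
record SignedGraph : Set₁ where
  field
    V   : Set
    pos : V → V → Set
    neg : V → V → Set

open SignedGraph public

record _≅_ (G H : SignedGraph) : Set where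
  field
    bij     : V G ↔ V H
  open Inverse bij public using (to)
  field
    pos-iff : ∀ x y → pos G x y ⇔ pos H (to x) (to y)
    neg-iff : ∀ x y → neg G x y ⇔ neg H (to x) (to y)

Z2^ : ℕ → Set
Z2^ k = Vec Bool k

_⊕_ : ∀ {k} → Z2^ k → Z2^ k → Z2^ k
_⊕_ = zipWith _xor_

e : ∀ {k} → Fin k → Z2^ k
e i = tabulate (λ j → ⌊ i ≟ j ⌋)

J : ∀ k → Z2^ k
J k = replicate k true

-- Signed Cayley graph (Γ, S⁺, S⁻) on Z_2^k (x - y = x ⊕ y in Z_2^k),
-- with S⁺, S⁻ given as predicates (symmetric automatically in Z_2^k).
SignedCayley : ∀ k → (Z2^ k → Set) → (Z2^ k → Set) → SignedGraph
SignedCayley k S⁺ S⁻ = record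
  { V   = Z2^ k
  ; pos = λ x y → S⁺ (x ⊕ y)
  ; neg = λ x y → S⁻ (x ⊕ y)
  }

SPC : ℕ → SignedGraph
SPC k = SignedCayley k (λ v → ∃[ i ] v ≡ e i) (λ v → v ≡ J k)

EDC : SignedGraph → SignedGraph
EDC G = record
  { V   = V G × Bool
  ; pos = λ { (x , a) (y , b) → (pos G x y × a ≡ b) ⊎ (neg G x y × ¬ a ≡ b) }
  ; neg = λ { (x , a) (y , b) → x ≡ y × ¬ a ≡ b }
  }

-- The map (x , a) ↦ (a , x + a·J) identifies the vertices of EDC(SPC n) with
-- ℤ₂ⁿ⁺¹, and the images of (x , a) and (y , b) differ by
-- (a + b , x + y + (a + b)·J). Hence a positive edge inside a layer
-- (x + y = e_j) is sent to e_{j+1}, a positive edge across the layers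
-- (x + y = J) to (1 , 0) = e₀, and the negative edge x₀x₁ to (1 , J) = J:
-- exactly the generators of SPC(n+1).
module Submission where

open import Defs
open import Data.Nat using (ℕ; zero; suc; _≤_; _∸_)
open import Data.Bool using (Bool; true; false; _xor_; if_then_else_)
open import Data.Bool.Properties using (xor-assoc; xor-same; xor-∧-commutativeRing)
open import Data.Fin using (Fin; zero; suc; _≟_)
open import Data.Vec using ([]; _∷_; map; replicate; tabulate)
open import Data.Vec.Properties using (map-id; map-replicate; tabulate-cong; ∷-injective; ∷-injectiveʳ)
open import Data.Product using (_×_; _,_; ∃-syntax)
open import Data.Product.Function.NonDependent.Propositional using (_×-⇔_)
open import Data.Sum using (_⊎_; inj₁; inj₂)
open import Data.Sum.Function.Propositional using (_⊎-⇔_)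
open import Data.Empty using (⊥-elim)
open import Relation.Nullary using (¬_)
open import Relation.Nullary.Decidable using (⌊⌋-map′)
open import Relation.Binary.PropositionalEquality using (_≡_; refl; sym; trans; cong; cong₂)
open import Function.Bundles using (_⇔_; mk⇔; mk↔ₛ′; module Equivalence)
import Function.Properties.Equivalence as ⇔
open import Algebra.Bundles using (CommutativeRing)
open import Algebra.Properties.CommutativeSemigroup
  (CommutativeRing.+-commutativeSemigroup xor-∧-commutativeRing) using (interchange)

xor≡false⇔≡ : ∀ a b → a xor b ≡ false ⇔ a ≡ b
xor≡false⇔≡ false false = mk⇔ (λ _ → refl) (λ _ → refl)
xor≡false⇔≡ false true  = mk⇔ (λ ()) (λ ())
xor≡false⇔≡ true  false = mk⇔ (λ ()) (λ ())
xor≡false⇔≡ true  true  = mk⇔ (λ _ → refl) (λ _ → refl)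

xor≡true⇔≢ : ∀ a b → a xor b ≡ true ⇔ (¬ a ≡ b)
xor≡true⇔≢ false false = mk⇔ (λ ()) (λ a≢b → ⊥-elim (a≢b refl))
xor≡true⇔≢ false true  = mk⇔ (λ _ ()) (λ _ → refl)
xor≡true⇔≢ true  false = mk⇔ (λ _ ()) (λ _ → refl)
xor≡true⇔≢ true  true  = mk⇔ (λ ()) (λ a≢b → ⊥-elim (a≢b refl))

select-⇔ : ∀ {P N : Set} d → ((P × d ≡ false) ⊎ (N × d ≡ true)) ⇔ (if d then N else P)
select-⇔ false = mk⇔ (λ { (inj₁ (p , _)) → p ; (inj₂ (_ , ())) }) (λ p → inj₁ (p , refl))
select-⇔ true  = mk⇔ (λ { (inj₁ (_ , ())) ; (inj₂ (q , _)) → q }) (λ q → inj₂ (q , refl))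

pos-EDC⇔ : ∀ (G : SignedGraph) {x y : V G} {a b : Bool} →
           pos (EDC G) (x , a) (y , b) ⇔ (if a xor b then neg G x y else pos G x y)
pos-EDC⇔ G {a = a} {b} = ⇔.trans
  (⇔.sym ((⇔.refl ×-⇔ xor≡false⇔≡ a b) ⊎-⇔ (⇔.refl ×-⇔ xor≡true⇔≢ a b)))
  (select-⇔ (a xor b))

zeros : ∀ n → Z2^ n
zeros n = replicate n false

∷-≡⇔ : ∀ {n} {u w : Bool} {x y : Z2^ n} → (u ∷ x ≡ w ∷ y) ⇔ (u ≡ w × x ≡ y)
∷-≡⇔ = mk⇔ ∷-injective (λ (p , q) → cong₂ _∷_ p q)

⊕≡zeros⇔≡ : ∀ {n} (x y : Z2^ n) → x ⊕ y ≡ zeros n ⇔ x ≡ y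
⊕≡zeros⇔≡ []       []       = mk⇔ (λ _ → refl) (λ _ → refl)
⊕≡zeros⇔≡ (u ∷ x) (w ∷ y) =
  ⇔.trans ∷-≡⇔ (⇔.trans (xor≡false⇔≡ u w ×-⇔ ⊕≡zeros⇔≡ x y) (⇔.sym ∷-≡⇔))

complementIf : ∀ {n} → Bool → Z2^ n → Z2^ n
complementIf a = map (a xor_)

complementIf-false : ∀ {n} (x : Z2^ n) → complementIf false x ≡ x
complementIf-false = map-id

complementIf-involutive : ∀ {n} a (x : Z2^ n) → complementIf a (complementIf a x) ≡ x
complementIf-involutive a []      = refl
complementIf-involutive a (u ∷ x) =
  cong₂ _∷_ (trans (sym (xor-assoc a a u)) (cong (_xor u) (xor-same a)))
            (complementIf-involutive a x)

complementIf-⊕ : ∀ {n} a b (x y : Z2^ n) →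
                 complementIf a x ⊕ complementIf b y ≡ complementIf (a xor b) (x ⊕ y)
complementIf-⊕ a b []      []      = refl
complementIf-⊕ a b (u ∷ x) (w ∷ y) = cong₂ _∷_ (interchange a u b w) (complementIf-⊕ a b x y)

complementIf-zeros : ∀ n → complementIf true (zeros n) ≡ J n
complementIf-zeros n = map-replicate (true xor_) false n

complementIf-J : ∀ n → complementIf true (J n) ≡ zeros n
complementIf-J n = map-replicate (true xor_) true n

complementIf≡zeros⇔≡J : ∀ {n} (x : Z2^ n) → complementIf true x ≡ zeros n ⇔ x ≡ J n
complementIf≡zeros⇔≡J {n} x = mk⇔
  (λ p → trans (sym (complementIf-involutive true x))
               (trans (cong (complementIf true) p) (complementIf-zeros n)))
  (λ { refl → complementIf-J n })

complementIf≡J⇔≡zeros : ∀ {n} (x : Z2^ n) → complementIf true x ≡ J n ⇔ x ≡ zeros n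
complementIf≡J⇔≡zeros {n} x = mk⇔
  (λ p → trans (sym (complementIf-involutive true x))
               (trans (cong (complementIf true) p) (complementIf-J n)))
  (λ { refl → complementIf-zeros n })

e-zero : ∀ {n} → e {suc n} zero ≡ true ∷ zeros n
e-zero {n} = cong (true ∷_) (tabulate-false n)
  where
  tabulate-false : ∀ n → tabulate (λ (_ : Fin n) → false) ≡ zeros n
  tabulate-false zero    = refl
  tabulate-false (suc n) = cong (false ∷_) (tabulate-false n)

e-suc : ∀ {n} (i : Fin n) → e {suc n} (suc i) ≡ false ∷ e i
e-suc i = cong (false ∷_) (tabulate-cong (λ j → ⌊⌋-map′ _ _ (i ≟ j)))

false∷≡e⇔ : ∀ {n} (x : Z2^ n) → (∃[ i ] false ∷ x ≡ e i) ⇔ (∃[ j ] x ≡ e j)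
false∷≡e⇔ x = mk⇔ to (λ (j , p) → suc j , trans (cong (false ∷_) p) (sym (e-suc j)))
  where
  to : ∃[ i ] false ∷ x ≡ e i → ∃[ j ] x ≡ e j
  to (zero  , ())
  to (suc j , p) = j , ∷-injectiveʳ (trans p (e-suc j))

true∷≡e⇔ : ∀ {n} (x : Z2^ n) → (∃[ i ] true ∷ x ≡ e i) ⇔ x ≡ zeros n
true∷≡e⇔ x = mk⇔ to (λ p → zero , trans (cong (true ∷_) p) (sym e-zero))
  where
  to : ∃[ i ] true ∷ x ≡ e i → x ≡ zeros _
  to (zero  , p) = ∷-injectiveʳ (trans p e-zero)
  to (suc j , ())

∷complementIf≡e⇔ : ∀ {n} d (z : Z2^ n) →
                   (∃[ i ] d ∷ complementIf d z ≡ e i) ⇔ (if d then z ≡ J n else ∃[ j ] z ≡ e j)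
∷complementIf≡e⇔ false z rewrite complementIf-false z = false∷≡e⇔ z
∷complementIf≡e⇔ true  z = ⇔.trans (true∷≡e⇔ _) (complementIf≡zeros⇔≡J z)

∷complementIf≡J⇔ : ∀ {n} d (z : Z2^ n) →
                   d ∷ complementIf d z ≡ J (suc n) ⇔ (z ≡ zeros n × d ≡ true)
∷complementIf≡J⇔ false z = mk⇔ (λ ()) (λ { (_ , ()) })
∷complementIf≡J⇔ true  z = mk⇔
  (λ p → Equivalence.to (complementIf≡J⇔≡zeros z) (∷-injectiveʳ p) , refl)
  (λ (p , _) → cong (true ∷_) (Equivalence.from (complementIf≡J⇔≡zeros z) p))

module _ {n : ℕ} where

  lift : V (EDC (SPC n)) → Z2^ (suc n)
  lift (x , a) = a ∷ complementIf a x

  unlift : Z2^ (suc n) → V (EDC (SPC n))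
  unlift (a ∷ v) = complementIf a v , a

  lift-⊕ : ∀ x a y b → lift (x , a) ⊕ lift (y , b) ≡ (a xor b) ∷ complementIf (a xor b) (x ⊕ y)
  lift-⊕ x a y b = cong ((a xor b) ∷_) (complementIf-⊕ a b x y)

  pos-lift⇔ : ∀ x a y b → pos (SPC (suc n)) (lift (x , a)) (lift (y , b))
                        ⇔ (if a xor b then neg (SPC n) x y else pos (SPC n) x y)
  pos-lift⇔ x a y b rewrite lift-⊕ x a y b = ∷complementIf≡e⇔ (a xor b) (x ⊕ y)

  neg-lift⇔ : ∀ x a y b → neg (SPC (suc n)) (lift (x , a)) (lift (y , b))
                        ⇔ neg (EDC (SPC n)) (x , a) (y , b)
  neg-lift⇔ x a y b rewrite lift-⊕ x a y b =
    ⇔.trans (∷complementIf≡J⇔ (a xor b) (x ⊕ y)) (⊕≡zeros⇔≡ x y ×-⇔ xor≡true⇔≢ a b)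

EDC-SPC : ∀ n → EDC (SPC n) ≅ SPC (suc n)
EDC-SPC n = record
  { bij     = mk↔ₛ′ lift unlift
                (λ { (a ∷ v) → cong (a ∷_) (complementIf-involutive a v) })
                (λ { (x , a) → cong (_, a) (complementIf-involutive a x) })
  ; pos-iff = λ { (x , a) (y , b) → ⇔.trans (pos-EDC⇔ (SPC n)) (⇔.sym (pos-lift⇔ x a y b)) }
  ; neg-iff = λ { (x , a) (y , b) → ⇔.sym (neg-lift⇔ x a y b) }
  }

-- The hypothesis only rules out k = 0; the isomorphism also holds for k = 1.
mainTheorem1 : ∀ (k : ℕ) → 2 ≤ k → EDC (SPC (k ∸ 1)) ≅ SPC k
mainTheorem1 zero    ()
mainTheorem1 (suc k) _ = EDC-SPC k
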